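{- Let $\Sigma$ be a finite totally ordered alphabet, let $\mathcal{M}$ be a finite multiset of nonempty strings over $\Sigma$, and let $\mathcal{S}\subseteq\mathcal{M}$ be a sub-multiset. Then (1) $\mathrm{EBWT}(\mathcal{S})$ is a subsequence of $\mathrm{EBWT}(\mathcal{M})$, and (2) $\mathrm{dolEBWT}(\mathcal{S})$ is a subsequence of $\mathrm{dolEBWT}(\mathcal{M})$.
   Context: A conjugate (rotation) of $T=T[1..n]$ is $T[i..n]T[1..i-1]$ for some $i$. For a string $T$, $T^\omega$ is the infinite concatenation $TTT\cdots$; every $T$ equals $U^k$ for a unique primitive $U$ and integer $k=\exp(T)$. The omega-order: $S\prec_\omega T$ iff $S^\omega<_{\mathrm{lex}}T^\omega$, or $S^\omega=T^\omega$ and $\exp(S)<\exp(T)$. For a multiset $\mathcal{N}$ of strings, $\mathrm{EBWT}(\mathcal{N})$ is the concatenation of the last characters of all conjugates of all strings of $\mathcal{N}$, listed in omega-order (ties broken by string index, then rotation position). With a symbol $\$$ smaller than every character of $\Sigma$, $\mathrm{dolEBWT}(\mathcal{N})=\mathrm{EBWT}(\{T\$ : T\in\mathcal{N}\})$ (the same $\$$ appended to every string, with multiplicities). A string $S$ is a subsequence of $T$ if $S$ is obtained from $T$ by deleting zero or more characters without changing the order of the remaining ones. -}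

module Defs where

open import Data.Nat as ℕ using (ℕ; zero; suc; NonZero)
open import Data.Nat.DivMod using (_mod_)
open import Data.Fin as Fin using (Fin)
open import Data.List using (List; []; _∷_; _++_; length; lookup; concat; replicate; map; _∷ʳ_; drop; take)
open import Data.List.Membership.Propositional using (_∈_)
open import Data.List.Relation.Unary.Linked using (Linked)
open import Data.List.Relation.Binary.Pointwise using (Pointwise)
open import Data.List.Relation.Binary.Permutation.Propositional using (_↭_)
open import Data.Maybe using (Maybe; just; nothing)
open import Data.Product using (Σ; ∃; ∃-syntax; _×_; _,_)
open import Data.Sum using (_⊎_)
open import Relation.Binary.PropositionalEquality using (_≡_)
open import Relation.Nullary using (¬_)

-- Strings over the alphabet Fin σ (a finite totally ordered alphabet of size σ,
-- ordered by Fin._<_; every finite total order is isomorphic to such an alphabet).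
Str : ℕ → Set
Str σ = List (Fin σ)

_^_ : {A : Set} → List A → ℕ → List A
U ^ k = concat (replicate k U)

Primitive : {A : Set} → List A → Set
Primitive U = ¬ (U ≡ []) × (∀ V k → U ≡ V ^ k → k ≡ 1)

Exp : {A : Set} → List A → ℕ → Set
Exp T k = ∃[ U ] (Primitive U × T ≡ U ^ k)

-- the i-th character of T^ω (nothing only for the empty string)
ωAt : {A : Set} → List A → ℕ → Maybe A
ωAt []       i = nothing
ωAt (x ∷ xs) i = just (lookup (x ∷ xs) (i mod suc (length xs)))

LtM : ∀ {σ} → Maybe (Fin σ) → Maybe (Fin σ) → Set
LtM (just a) (just b) = a Fin.< b
LtM _        _        = Data.Empty.⊥
  where import Data.Empty

ωEq : ∀ {σ} → Str σ → Str σ → Set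
ωEq S T = ∀ i → ωAt S i ≡ ωAt T i

ωLex : ∀ {σ} → Str σ → Str σ → Set
ωLex S T = ∃[ i ] ((∀ j → j ℕ.< i → ωAt S j ≡ ωAt T j) × LtM (ωAt S i) (ωAt T i))

_≺ω_ : ∀ {σ} → Str σ → Str σ → Set
S ≺ω T = ωLex S T ⊎ (ωEq S T × ∃[ p ] ∃[ q ] (Exp S p × Exp T q × p ℕ.< q))

-- conjugate T[j..n]T[1..j-1] (0-based rotation start j)
rot : {A : Set} → List A → ℕ → List A
rot T j = drop j T ++ take j T

Pos : ∀ {σ} → List (Str σ) → Set
Pos N = Σ (Fin (length N)) λ i → Fin (length (lookup N i))

conj : ∀ {σ} (N : List (Str σ)) → Pos N → Str σ
conj N (i , j) = rot (lookup N i) (Fin.toℕ j)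

ConjLt : ∀ {σ} (N : List (Str σ)) → Pos N → Pos N → Set
ConjLt N (i , j) (i' , j') =
  conj N (i , j) ≺ω conj N (i' , j')
  ⊎ (¬ (conj N (i' , j') ≺ω conj N (i , j)) × ¬ (conj N (i , j) ≺ω conj N (i' , j'))
     × (Fin.toℕ i ℕ.< Fin.toℕ i' ⊎ (Fin.toℕ i ≡ Fin.toℕ i' × Fin.toℕ j ℕ.< Fin.toℕ j')))

LastOf : {A : Set} → List A → A → Set
LastOf C c = ∃[ xs ] (C ≡ xs ∷ʳ c)

-- IsEBWT N L : L is EBWT(N), i.e. the last characters of all conjugates of all
-- strings of N, listed in the above order (an enumeration of all conjugate
-- positions, strictly sorted, hence each exactly once).
IsEBWT : ∀ {σ} → List (Str σ) → Str σ → Set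
IsEBWT N L =
  ∃[ enum ] ( (∀ p → p ∈ enum)
            × Linked (ConjLt N) enum
            × Pointwise (λ p c → LastOf (conj N p) c) enum L)

-- T$ over the extended alphabet Fin (suc σ), where $ = zero is smallest and
-- the original characters are shifted by suc (order preserved)
dol : ∀ {σ} → Str σ → Str (suc σ)
dol T = map Fin.suc T ∷ʳ Fin.zero

IsDolEBWT : ∀ {σ} → List (Str σ) → Str (suc σ) → Set
IsDolEBWT N L = IsEBWT (map dol N) L

SubMultiset : {A : Set} → List A → List A → Set
SubMultiset S M = ∃[ R ] ((S ++ R) ↭ M)

{-# OPTIONS --safe #-}
-- For nonempty words an ω-order tie is an equality: equal
-- infinite powers and equal exponents force equal primitive roots, because two periods of
-- an infinite word give their gcd as a period (Bézout), and a primitive word has no proper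
-- period dividing its length.  So the EBWT reads off the conjugates sorted by a partial
-- order whose ties are equalities.  The conjugates of S together with those of M ∖ S
-- rearrange the conjugates of M, and a sorted sub-multiset of a sorted list is a sublist
-- of it (by comparing heads, antisymmetry settling the tie); taking last characters keeps
-- sublists.  For dolEBWT the same applies to the nonempty strings T$.
module Submission where

open import Defs
open import Data.Nat using (ℕ; suc)
open import Data.List using (List; [])
open import Data.List.Relation.Unary.All using (All)
open import Data.List.Relation.Binary.Sublist.Propositional using (_⊆_)
open import Data.Product using (_×_)
open import Relation.Binary.PropositionalEquality using (_≡_)
open import Relation.Nullary using (¬_)

open import Data.Nat using (zero; _+_; _*_; _<_; _≤_; _<?_; z≤n; s≤s; NonZero; ≢-nonZero; ≢-nonZero⁻¹)
open import Data.Nat.Properties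
  using ( +-assoc; +-comm; *-comm; *-identityˡ; *-cancelʳ-≡; +-cancelˡ-<; m≤m+n; m<m*n; ≮⇒≥; <-≤-trans
        ; m≤n⇒∃[o]m+o≡n; m≤n⇒m⊓n≡m; <-irrefl; <-trans; <-cmp; module ≤-Reasoning)
open import Data.Nat.DivMod using (_%_; _/_; _mod_; m≡m%n+[m/n]*n; m%n<n; m<n⇒m%n≡m; [m+n]%n≡m%n)
open import Data.Nat.Divisibility using (_∣_; divides)
open import Data.Nat.GCD using (gcd; gcd-GCD; gcd[m,n]∣m; gcd[m,n]∣n; gcd[m,n]≢0; module Bézout)
open import Data.Nat.Induction using (<-rec; <-wellFounded)
open import Data.Fin as Fin using (Fin; toℕ)
open import Data.Fin.Properties using (toℕ-fromℕ<; toℕ<n)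
import Data.Fin.Properties as Fin
open import Data.Maybe using (Maybe; just; nothing)
open import Data.Maybe.Properties using (just-injective)
open import Data.List using (_∷_; _++_; [_]; length; lookup; map; concatMap; allFin; take; drop)
open import Data.List.Properties
  using (length-++; length-take; ++-assoc; ++-identityʳ; ++-conicalˡ; ++-conicalʳ; take++drop≡id
        ; ∷ʳ-injectiveʳ; map-++; map-∘; map-id; concatMap-++; ≡-dec)
import Data.List.Relation.Unary.All as All
open import Data.List.Relation.Unary.All.Properties using (++⁻ˡ) renaming (map⁺ to All-map⁺)
import Data.List.Relation.Unary.AllPairs as AllPairs
open import Data.List.Relation.Unary.Any using (here; there)
open import Data.List.Relation.Unary.Linked using (Linked)
import Data.List.Relation.Unary.Linked as Linked
open import Data.List.Relation.Unary.Linked.Properties using (Linked⇒AllPairs) renaming (map⁺ to Linked-map⁺)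
open import Data.List.Relation.Unary.Unique.Propositional using (Unique)
import Data.List.Relation.Unary.Unique.Propositional.Properties as Unique
open import Data.List.Relation.Binary.Pointwise using (Pointwise; []; _∷_; Pointwise-≡⇒≡)
import Data.List.Relation.Binary.Pointwise as Pointwise
open import Data.List.Relation.Binary.Sublist.Propositional using ([]; _∷_; _∷ʳ_; minimum)
open import Data.List.Relation.Binary.Permutation.Propositional using (_↭_; ↭-sym; ↭-trans; ↭-reflexive)
open import Data.List.Relation.Binary.Permutation.Propositional.Properties
  using (++⁺ˡ; ++⁺ʳ; shift; drop-∷; ∈-resp-↭; All-resp-↭; ¬x∷xs↭[]) renaming (map⁺ to ↭-map⁺)
open import Data.List.Relation.Binary.BagAndSetEquality using (∼bag⇒↭; ↭⇒∼bag; map-cong; concat-cong)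
open import Data.List.Membership.Propositional using (_∈_)
open import Data.List.Membership.Propositional.Properties
  using (∈-map⁺; ∈-map⁻; ∈-++⁺ˡ; ∈-++⁺ʳ; ∈-++⁻; ∈-∃++; ∈-allFin; ∈-lookup)
open import Data.List.Membership.Propositional.Properties.WithK using (unique∧set⇒bag)
open import Data.Product using (∃; ∃-syntax; _,_; proj₁)
open import Data.Product.Relation.Binary.Lex.Strict using (×-Lex; ×-transitive)
open import Data.Sum using (inj₁; inj₂)
open import Data.Empty using (⊥-elim)
open import Function using (_∘_; id)
open import Function.Bundles using (mk⇔)
open import Induction.WellFounded using (Acc; acc)
open import Relation.Binary.Definitions using (Transitive; Irreflexive; Antisymmetric; tri<; tri≈; tri>)
open import Relation.Binary.PropositionalEquality
  using (_≢_; _≗_; refl; sym; trans; cong; cong₂; cong-app; subst; resp₂; isEquivalence; module ≡-Reasoning)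
import Relation.Binary.Construct.StrictToNonStrict as StrictToNonStrict
open import Relation.Nullary.Decidable using (yes; no; decidable-stable)

private
  variable
    A : Set
    σ : ℕ

record Period (f : ℕ → A) (p : ℕ) : Set where
  constructor period
  field periodic : ∀ i → f (p + i) ≡ f i

open Period

module _ {f : ℕ → A} where

  Period-* : ∀ {p} k → Period f p → Period f (k * p)
  Period-* zero    _   = period λ _ → refl
  Period-* {p} (suc k) per = period λ i →
    trans (cong f (+-assoc p (k * p) i)) (trans (periodic per _) (periodic (Period-* k per) i))

  Period-% : ∀ {p} .{{_ : NonZero p}} → Period f p → ∀ i → f i ≡ f (i % p)
  Period-% {p} per i = begin
    f i                   ≡⟨ cong f (m≡m%n+[m/n]*n i p) ⟩
    f (i % p + i / p * p) ≡⟨ cong f (+-comm (i % p) _) ⟩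
    f (i / p * p + i % p) ≡⟨ periodic (Period-* (i / p) per) (i % p) ⟩
    f (i % p)             ∎
    where open ≡-Reasoning

  Period-Bézout : ∀ {m n d} x y → Period f m → Period f n → d + x * m ≡ y * n → Period f d
  Period-Bézout {m} {n} {d} x y per-m per-n eq = period λ i → begin
    f (d + i)           ≡⟨ periodic (Period-* x per-m) (d + i) ⟨
    f (x * m + (d + i)) ≡⟨ cong f (trans (sym (+-assoc (x * m) d i)) (cong (_+ i) (+-comm (x * m) d))) ⟩
    f (d + x * m + i)   ≡⟨ cong (λ k → f (k + i)) eq ⟩
    f (y * n + i)       ≡⟨ periodic (Period-* y per-n) i ⟩
    f i                 ∎
    where open ≡-Reasoning

  Period-gcd : ∀ {m n} → Period f m → Period f n → Period f (gcd m n)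
  Period-gcd {m} {n} per-m per-n with Bézout.identity (gcd-GCD m n)
  ... | Bézout.+- x y eq = Period-Bézout y x per-n per-m eq
  ... | Bézout.-+ x y eq = Period-Bézout x y per-m per-n eq

Period-resp-≗ : ∀ {f g : ℕ → A} {p} → f ≗ g → Period f p → Period g p
Period-resp-≗ f≗g per = period λ i → trans (sym (f≗g _)) (trans (periodic per i) (f≗g i))

Period-ext : ∀ {f g : ℕ → A} p .{{_ : NonZero p}} → Period f p → Period g p →
             (∀ i → i < p → f i ≡ g i) → f ≗ g
Period-ext p per-f per-g agree i =
  trans (Period-% per-f i) (trans (agree _ (m%n<n i p)) (sym (Period-% per-g i)))

at : List A → ℕ → Maybe A
at []       _       = nothing
at (x ∷ _)  zero    = just x
at (_ ∷ xs) (suc i) = at xs i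

at-lookup : ∀ (xs : List A) i → at xs (toℕ i) ≡ just (lookup xs i)
at-lookup (_ ∷ _)  Fin.zero    = refl
at-lookup (_ ∷ xs) (Fin.suc i) = at-lookup xs i

at-++ˡ : ∀ (xs ys : List A) {i} → i < length xs → at (xs ++ ys) i ≡ at xs i
at-++ˡ (_ ∷ _)  ys {zero}  _         = refl
at-++ˡ (_ ∷ xs) ys {suc i} (s≤s i<n) = at-++ˡ xs ys i<n

at-++ʳ : ∀ (xs ys : List A) i → at (xs ++ ys) (length xs + i) ≡ at ys i
at-++ʳ []       ys i = refl
at-++ʳ (_ ∷ xs) ys i = at-++ʳ xs ys i

at-take : ∀ (xs : List A) {d i} → i < d → at (take d xs) i ≡ at xs i
at-take []       {suc d}         _         = refl
at-take (_ ∷ _)  {suc d} {zero}  _         = refl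
at-take (_ ∷ xs) {suc d} {suc i} (s≤s i<d) = at-take xs i<d

ωAt-% : ∀ (x : A) xs i → ωAt (x ∷ xs) i ≡ at (x ∷ xs) (i % suc (length xs))
ωAt-% x xs i = trans (sym (at-lookup (x ∷ xs) (i mod n))) (cong (at (x ∷ xs)) (toℕ-fromℕ< (m%n<n i n)))
  where n = suc (length xs)

ωAt-< : ∀ (T : List A) {i} → i < length T → ωAt T i ≡ at T i
ωAt-< (x ∷ xs) {i} i<n = trans (ωAt-% x xs i) (cong (at (x ∷ xs)) (m<n⇒m%n≡m i<n))

ωAt-period : ∀ (T : List A) → Period (ωAt T) (length T)
ωAt-period []       = period λ _ → refl
ωAt-period (x ∷ xs) = period λ i → begin
  ωAt (x ∷ xs) (n + i)      ≡⟨ ωAt-% x xs (n + i) ⟩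
  at (x ∷ xs) ((n + i) % n) ≡⟨ cong (λ k → at (x ∷ xs) (k % n)) (+-comm n i) ⟩
  at (x ∷ xs) ((i + n) % n) ≡⟨ cong (at (x ∷ xs)) ([m+n]%n≡m%n i n) ⟩
  at (x ∷ xs) (i % n)       ≡⟨ ωAt-% x xs i ⟨
  ωAt (x ∷ xs) i            ∎
  where
  open ≡-Reasoning
  n = suc (length xs)

ωAt-lookup : ∀ (T : List A) i → ωAt T (toℕ i) ≡ just (lookup T i)
ωAt-lookup T i = trans (ωAt-< T (toℕ<n i)) (at-lookup T i)

ωAt-injective : ∀ (X Y : List A) → length X ≡ length Y → ωAt X ≗ ωAt Y → X ≡ Y
ωAt-injective X Y |X|≡|Y| X≗Y = Pointwise-≡⇒≡ (Pointwise.lookup⁻ |X|≡|Y| same-letter)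
  where
  same-letter : ∀ {i j} → toℕ i ≡ toℕ j → lookup X i ≡ lookup Y j
  same-letter {i} {j} i≡j = just-injective (begin
    just (lookup X i) ≡⟨ ωAt-lookup X i ⟨
    ωAt X (toℕ i)     ≡⟨ X≗Y (toℕ i) ⟩
    ωAt Y (toℕ i)     ≡⟨ cong (ωAt Y) i≡j ⟩
    ωAt Y (toℕ j)     ≡⟨ ωAt-lookup Y j ⟩
    just (lookup Y j) ∎)
    where open ≡-Reasoning

length-^ : ∀ (U : List A) k → length (U ^ k) ≡ k * length U
length-^ U zero    = refl
length-^ U (suc k) = trans (length-++ U) (cong (length U +_) (length-^ U k))

[]^k≡[] : ∀ k → ([] {A = A}) ^ k ≡ []
[]^k≡[] zero    = refl
[]^k≡[] (suc k) = []^k≡[] k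

^-+ : ∀ (U : List A) m n → U ^ (m + n) ≡ U ^ m ++ U ^ n
^-+ U zero    n = refl
^-+ U (suc m) n = trans (cong (U ++_) (^-+ U m n)) (sym (++-assoc U (U ^ m) (U ^ n)))

^-* : ∀ (U : List A) m k → (U ^ m) ^ k ≡ U ^ (k * m)
^-* U m zero    = refl
^-* U m (suc k) = trans (cong (U ^ m ++_) (^-* U m k)) (sym (^-+ U m (k * m)))

^-injectiveʳ : ∀ (U : List A) {m n} → U ≢ [] → U ^ m ≡ U ^ n → m ≡ n
^-injectiveʳ []          U≢[] _  = ⊥-elim (U≢[] refl)
^-injectiveʳ U@(_ ∷ _) {m} {n} _ eq = *-cancelʳ-≡ m n (length U) (begin
  m * length U   ≡⟨ length-^ U m ⟨
  length (U ^ m) ≡⟨ cong length eq ⟩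
  length (U ^ n) ≡⟨ length-^ U n ⟩
  n * length U   ∎)
  where open ≡-Reasoning

^-length-< : ∀ (V : List A) k → V ≢ [] → 1 < k → length V < length (V ^ k)
^-length-< []          k V≢[] _ = ⊥-elim (V≢[] refl)
^-length-< V@(_ ∷ _) k _ 1<k = begin-strict
  length V       <⟨ m<m*n (length V) k 1<k ⟩
  length V * k   ≡⟨ *-comm (length V) k ⟩
  k * length V   ≡⟨ length-^ V k ⟨
  length (V ^ k) ∎
  where open ≤-Reasoning

at-^ : ∀ (U : List A) k {i} → i < k * length U → at (U ^ k) i ≡ ωAt U i
at-^ U (suc k) {i} i<n with i <? length U
... | yes i<|U| = trans (at-++ˡ U (U ^ k) i<|U|) (sym (ωAt-< U i<|U|))
... | no i≮|U| with j , refl ← m≤n⇒∃[o]m+o≡n (≮⇒≥ i≮|U|) = begin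
  at (U ^ suc k) (length U + j) ≡⟨ at-++ʳ U (U ^ k) j ⟩
  at (U ^ k) j                  ≡⟨ at-^ U k (+-cancelˡ-< (length U) j (k * length U) i<n) ⟩
  ωAt U j                       ≡⟨ periodic (ωAt-period U) j ⟨
  ωAt U (length U + j)          ∎
  where open ≡-Reasoning

ωAt-^ : ∀ (U : List A) k → U ≢ [] → ωAt (U ^ suc k) ≗ ωAt U
ωAt-^ []          k U≢[] = ⊥-elim (U≢[] refl)
ωAt-^ U@(_ ∷ _) k _    = Period-ext (suc k * length U) per-Uᵏ (Period-* (suc k) (ωAt-period U)) agree
  where
  per-Uᵏ : Period (ωAt (U ^ suc k)) (suc k * length U)
  per-Uᵏ = subst (Period (ωAt (U ^ suc k))) (length-^ U (suc k)) (ωAt-period (U ^ suc k))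
  agree : ∀ i → i < suc k * length U → ωAt (U ^ suc k) i ≡ ωAt U i
  agree i i<n =
    trans (ωAt-< (U ^ suc k) (subst (i <_) (sym (length-^ U (suc k))) i<n)) (at-^ U (suc k) i<n)

divisor-period⇒power : ∀ (T : List A) d k .{{_ : NonZero d}} →
                       length T ≡ k * d → Period (ωAt T) d → T ≡ take d T ^ k
divisor-period⇒power []      d zero    _  _   = refl
divisor-period⇒power (_ ∷ _) d zero    () _
divisor-period⇒power T       d (suc k) |T|≡ per =
  ωAt-injective T (W ^ suc k) |T|≡|Wᵏ| (λ i → trans (sym (W≗T i)) (sym (ωAt-^ W k W≢[] i)))
  where
  W = take d T
  d≤|T| : d ≤ length T
  d≤|T| = subst (d ≤_) (sym |T|≡) (m≤m+n d (k * d))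
  |W|≡d : length W ≡ d
  |W|≡d = trans (length-take d T) (m≤n⇒m⊓n≡m d≤|T|)
  |T|≡|Wᵏ| : length T ≡ length (W ^ suc k)
  |T|≡|Wᵏ| = trans |T|≡ (trans (cong (suc k *_) (sym |W|≡d)) (sym (length-^ W (suc k))))
  W≢[] : W ≢ []
  W≢[] W≡[] = ≢-nonZero⁻¹ d (trans (sym |W|≡d) (cong length W≡[]))
  W≗T : ωAt W ≗ ωAt T
  W≗T = Period-ext d (subst (Period (ωAt W)) |W|≡d (ωAt-period W)) per λ i i<d →
    trans (ωAt-< W (subst (i <_) (sym |W|≡d) i<d))
          (trans (at-take T i<d) (sym (ωAt-< T (<-≤-trans i<d d≤|T|))))

primitive-period : ∀ {U : List A} d .{{_ : NonZero d}} →
                   Primitive U → d ∣ length U → Period (ωAt U) d → d ≡ length U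
primitive-period {U = U} d (_ , not-a-power) (divides k |U|≡kd) per = begin
  d        ≡⟨ *-identityˡ d ⟨
  1 * d    ≡⟨ cong (_* d) (not-a-power (take d U) k (divisor-period⇒power U d k |U|≡kd per)) ⟨
  k * d    ≡⟨ |U|≡kd ⟨
  length U ∎
  where open ≡-Reasoning

primitive-ω-unique : ∀ {U V : List A} → Primitive U → Primitive V → ωAt U ≗ ωAt V → U ≡ V
primitive-ω-unique {U = []}        (U≢[] , _) _ _ = ⊥-elim (U≢[] refl)
primitive-ω-unique {U = U@(_ ∷ _)} {V} pU pV U≗V =
  ωAt-injective U V (trans (sym d≡|U|) d≡|V|) U≗V
  where
  d = gcd (length U) (length V)
  instance
    d≢0 : NonZero d
    d≢0 = ≢-nonZero (gcd[m,n]≢0 (length U) (length V) (inj₁ λ ()))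
  per-U : Period (ωAt U) d
  per-U = Period-gcd (ωAt-period U) (Period-resp-≗ (λ i → sym (U≗V i)) (ωAt-period V))
  d≡|U| : d ≡ length U
  d≡|U| = primitive-period d pU (gcd[m,n]∣m (length U) (length V)) per-U
  d≡|V| : d ≡ length V
  d≡|V| = primitive-period d pV (gcd[m,n]∣n (length U) (length V)) (Period-resp-≗ U≗V per-U)

roots-ω-unique : ∀ {U V : List A} p q → Primitive U → Primitive V →
                 ωAt (U ^ suc p) ≗ ωAt (V ^ suc q) → U ≡ V
roots-ω-unique {U = U} {V} p q pU pV Uᵖ≗Vᵠ = primitive-ω-unique pU pV λ i → begin
  ωAt U i           ≡⟨ ωAt-^ U p (proj₁ pU) i ⟨
  ωAt (U ^ suc p) i ≡⟨ Uᵖ≗Vᵠ i ⟩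
  ωAt (V ^ suc q) i ≡⟨ ωAt-^ V q (proj₁ pV) i ⟩
  ωAt V i           ∎
  where open ≡-Reasoning

Exp-unique : ∀ {T : List A} {p q} → Exp T p → Exp T q → p ≡ q
Exp-unique {p = zero}  {zero}  _ _ = refl
Exp-unique {p = zero}  {suc q} (_ , _ , T≡[]) (V , (V≢[] , _) , T≡Vᵠ) =
  ^-injectiveʳ V V≢[] (trans (sym T≡[]) T≡Vᵠ)
Exp-unique {p = suc p} {zero}  expᵖ exp⁰ = sym (Exp-unique exp⁰ expᵖ)
Exp-unique {p = suc p} {suc q} (U , pU , T≡Uᵖ) (V , pV , T≡Vᵠ)
  with refl ← roots-ω-unique p q pU pV (cong-app (cong ωAt (trans (sym T≡Uᵖ) T≡Vᵠ)))
  = ^-injectiveʳ U (proj₁ pU) (trans (sym T≡Uᵖ) T≡Vᵠ)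

ωAt≗-Exp⇒≡ : ∀ {S T : List A} k → ωAt S ≗ ωAt T → Exp S k → Exp T k → S ≡ T
ωAt≗-Exp⇒≡ zero    _   (_ , _ , S≡[]) (_ , _ , T≡[]) = trans S≡[] (sym T≡[])
ωAt≗-Exp⇒≡ (suc k) S≗T (U , pU , S≡Uᵏ) (V , pV , T≡Vᵏ)
  with refl ← roots-ω-unique k k pU pV (λ i →
                trans (cong-app (cong ωAt (sym S≡Uᵏ)) i) (trans (S≗T i) (cong-app (cong ωAt T≡Vᵏ) i)))
  = trans S≡Uᵏ (sym T≡Vᵏ)

-- Double negation spares us deciding whether T is a proper power: if T had no exponent it
-- would be primitive, since from T = V ^ k with k ≥ 2 an exponent of the shorter V lifts to T.
Exp-exists : ∀ {T : List A} → T ≢ [] → ¬ ¬ ∃ (Exp T)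
Exp-exists {T = T} = go (<-wellFounded (length T))
  where
  go : ∀ {T : List _} → Acc _<_ (length T) → T ≢ [] → ¬ ¬ ∃ (Exp T)
  go {T} (acc shorter) T≢[] no-exp = no-exp (1 , T , (T≢[] , T-not-a-power) , sym (++-identityʳ T))
    where
    T-not-a-power : ∀ V k → T ≡ V ^ k → k ≡ 1
    T-not-a-power V zero             T≡[] = ⊥-elim (T≢[] T≡[])
    T-not-a-power V (suc zero)       _    = refl
    T-not-a-power V k@(suc (suc _)) T≡Vᵏ =
      ⊥-elim (go (shorter |V|<|T|) V≢[] λ { (m , U , pU , V≡Uᵐ) →
        no-exp (k * m , U , pU , trans T≡Vᵏ (trans (cong (_^ k) V≡Uᵐ) (^-* U m k))) })
      where
      V≢[] : V ≢ []
      V≢[] V≡[] = T≢[] (trans T≡Vᵏ (trans (cong (_^ k) V≡[]) ([]^k≡[] k)))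
      |V|<|T| : length V < length T
      |V|<|T| = subst (length V <_) (cong length (sym T≡Vᵏ)) (^-length-< V k V≢[] (s≤s (s≤s z≤n)))

LtM-irrefl : ∀ (c : Maybe (Fin σ)) → ¬ LtM c c
LtM-irrefl (just a) = Fin.<-irrefl refl
LtM-irrefl nothing  ()

LtM-trans : ∀ (a b c : Maybe (Fin σ)) → LtM a b → LtM b c → LtM a c
LtM-trans (just a) (just b) (just c) = Fin.<-trans
LtM-trans (just a) (just b) nothing  _  ()
LtM-trans (just a) nothing  _        () _
LtM-trans nothing  _        _        () _

ωLex-irrefl : ∀ {S : Str σ} → ¬ ωLex S S
ωLex-irrefl {S = S} (i , _ , lt) = LtM-irrefl (ωAt S i) lt

ωLex-trans : ∀ {S T U : Str σ} → ωLex S T → ωLex T U → ωLex S U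
ωLex-trans {S = S} {T} {U} (i , S=T , S<T) (j , T=U , T<U) with <-cmp i j
... | tri< i<j _ _ =
  i , (λ k k<i → trans (S=T k k<i) (T=U k (<-trans k<i i<j))) , subst (LtM (ωAt S i)) (T=U i i<j) S<T
... | tri≈ _ refl _ =
  i , (λ k k<i → trans (S=T k k<i) (T=U k k<i)) , LtM-trans (ωAt S i) (ωAt T i) (ωAt U i) S<T T<U
... | tri> _ _ j<i =
  j , (λ k k<j → trans (S=T k (<-trans k<j j<i)) (T=U k k<j)) ,
  subst (λ c → LtM c (ωAt U j)) (sym (S=T j j<i)) T<U

ωLex-respʳ-ωEq : ∀ {S T U : Str σ} → ωLex S T → ωEq T U → ωLex S U
ωLex-respʳ-ωEq {S = S} (i , S=T , S<T) T=U =
  i , (λ k k<i → trans (S=T k k<i) (T=U k)) , subst (LtM (ωAt S i)) (T=U i) S<T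

ωLex-respˡ-ωEq : ∀ {S T U : Str σ} → ωEq S T → ωLex T U → ωLex S U
ωLex-respˡ-ωEq {U = U} S=T (i , T=U , T<U) =
  i , (λ k k<i → trans (S=T k) (T=U k k<i)) , subst (λ c → LtM c (ωAt U i)) (sym (S=T i)) T<U

≺ω-irrefl : Irreflexive _≡_ (_≺ω_ {σ})
≺ω-irrefl refl (inj₁ S<S)                              = ωLex-irrefl S<S
≺ω-irrefl refl (inj₂ (_ , p , q , expᵖ , expᵠ , p<q)) = <-irrefl (Exp-unique expᵖ expᵠ) p<q

≺ω-trans : Transitive (_≺ω_ {σ})
≺ω-trans (inj₁ S<T)        (inj₁ T<U)        = inj₁ (ωLex-trans S<T T<U)
≺ω-trans (inj₁ S<T)        (inj₂ (T=U , _))  = inj₁ (ωLex-respʳ-ωEq S<T T=U)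
≺ω-trans (inj₂ (S=T , _))  (inj₁ T<U)        = inj₁ (ωLex-respˡ-ωEq S=T T<U)
≺ω-trans (inj₂ (S=T , p , q , expᵖ , expᵠ , p<q)) (inj₂ (T=U , q′ , r , expᵠ′ , expʳ , q′<r)) =
  inj₂ ((λ i → trans (S=T i) (T=U i)) , p , r , expᵖ , expʳ ,
        <-trans p<q (subst (_< r) (Exp-unique expᵠ′ expᵠ) q′<r))

ωLex-tie⇒ωEq : ∀ {S T : Str σ} → S ≢ [] → T ≢ [] → ¬ ωLex S T → ¬ ωLex T S → ωEq S T
ωLex-tie⇒ωEq {S = []}          S≢[] _    _   _   = ⊥-elim (S≢[] refl)
ωLex-tie⇒ωEq {S = _ ∷ _} {[]} _    T≢[] _   _   = ⊥-elim (T≢[] refl)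
ωLex-tie⇒ωEq {S = S@(_ ∷ _)} {T@(_ ∷ _)} _ _ S≮T T≮S = <-rec _ agree-up-to
  where
  agree-up-to : ∀ n → (∀ {j} → j < n → ωAt S j ≡ ωAt T j) → ωAt S n ≡ ωAt T n
  agree-up-to n below with Fin.<-cmp (lookup S (n mod length S)) (lookup T (n mod length T))
  ... | tri< S<T _ _ = ⊥-elim (S≮T (n , (λ j j<n → below j<n) , S<T))
  ... | tri≈ _ S=T _ = cong just S=T
  ... | tri> _ _ T<S = ⊥-elim (T≮S (n , (λ j j<n → sym (below j<n)) , T<S))

≺ω-tie⇒≡ : ∀ {S T : Str σ} → S ≢ [] → T ≢ [] → ¬ S ≺ω T → ¬ T ≺ω S → S ≡ T
≺ω-tie⇒≡ {S = S} {T} S≢[] T≢[] S⊀T T⊀S = decidable-stable (≡-dec Fin._≟_ S T) λ S≢T →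
  Exp-exists S≢[] λ { (p , expS) → Exp-exists T≢[] λ { (q , expT) → S≢T (equal-exps p q expS expT) } }
  where
  S=T : ωEq S T
  S=T = ωLex-tie⇒ωEq S≢[] T≢[] (S⊀T ∘ inj₁) (T⊀S ∘ inj₁)
  equal-exps : ∀ p q → Exp S p → Exp T q → S ≡ T
  equal-exps p q expS expT with <-cmp p q
  ... | tri< p<q _ _ = ⊥-elim (S⊀T (inj₂ (S=T , p , q , expS , expT , p<q)))
  ... | tri≈ _ refl _ = ωAt≗-Exp⇒≡ p S=T expS expT
  ... | tri> _ _ q<p = ⊥-elim (T⊀S (inj₂ ((λ i → sym (S=T i)) , q , p , expT , expS , q<p)))

_≼ω_ : Str σ → Str σ → Set
_≼ω_ = StrictToNonStrict._≤_ _≡_ _≺ω_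

≼ω-trans : Transitive (_≼ω_ {σ})
≼ω-trans = StrictToNonStrict.trans _≡_ _≺ω_ isEquivalence (resp₂ _≺ω_) ≺ω-trans

≼ω-antisym : Antisymmetric _≡_ (_≼ω_ {σ})
≼ω-antisym = StrictToNonStrict.antisym _≡_ _≺ω_ isEquivalence ≺ω-trans ≺ω-irrefl

module _ {_≤_ : A → A → Set} (≤-trans : Transitive _≤_) (≤-antisym : Antisymmetric _≡_ _≤_) where

  Linked-head-≤ : ∀ {x z xs} → Linked _≤_ (x ∷ xs) → z ∈ xs → x ≤ z
  Linked-head-≤ sorted z∈xs with x≤xs AllPairs.∷ _ ← Linked⇒AllPairs ≤-trans sorted = All.lookup x≤xs z∈xs

  sorted-heads-≡ : ∀ {x y xs ys zs} → Linked _≤_ (x ∷ xs) → Linked _≤_ (y ∷ ys) →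
                   (x ∷ xs) ++ zs ↭ y ∷ ys → y ∈ x ∷ xs → x ≡ y
  sorted-heads-≡ _  _  _ (here y≡x)   = sym y≡x
  sorted-heads-≡ sx sy p (there y∈xs) with ∈-resp-↭ p (here refl)
  ... | here x≡y    = x≡y
  ... | there x∈ys  = ≤-antisym (Linked-head-≤ sx y∈xs) (Linked-head-≤ sy x∈ys)

  sorted-++-↭⇒⊆ : ∀ {xs ys zs} → Linked _≤_ xs → Linked _≤_ ys → xs ++ zs ↭ ys → xs ⊆ ys
  sorted-++-↭⇒⊆ {[]}              _  _  _ = minimum _
  sorted-++-↭⇒⊆ {_ ∷ _} {[]}      _  _  p = ⊥-elim (¬x∷xs↭[] p)
  sorted-++-↭⇒⊆ {x ∷ xs} {y ∷ ys} sx sy p with ∈-++⁻ (x ∷ xs) (∈-resp-↭ (↭-sym p) (here refl))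
  ... | inj₁ y∈x∷xs with refl ← sorted-heads-≡ sx sy p y∈x∷xs =
    refl ∷ sorted-++-↭⇒⊆ (Linked.tail sx) (Linked.tail sy) (drop-∷ p)
  ... | inj₂ y∈zs with zs₁ , zs₂ , refl ← ∈-∃++ y∈zs =
    y ∷ʳ sorted-++-↭⇒⊆ sx (Linked.tail sy) (drop-∷ (↭-trans (↭-sym y-to-front) p))
    where
    y-to-front : (x ∷ xs) ++ zs₁ ++ y ∷ zs₂ ↭ y ∷ (x ∷ xs) ++ zs₁ ++ zs₂
    y-to-front = ↭-trans (++⁺ˡ (x ∷ xs) (shift y zs₁ zs₂)) (shift y (x ∷ xs) (zs₁ ++ zs₂))

Pointwise-image-⊆ : ∀ {B C : Set} {R : B → C → Set} → (∀ {b c c′} → R b c → R b c′ → c ≡ c′) →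
                    ∀ {xs ys L₁ L₂} → xs ⊆ ys → Pointwise R xs L₁ → Pointwise R ys L₂ → L₁ ⊆ L₂
Pointwise-image-⊆ functional []             []          []           = []
Pointwise-image-⊆ functional (_ ∷ʳ xs⊆ys)   Rxs         (_ ∷ Rys)    =
  _ ∷ʳ Pointwise-image-⊆ functional xs⊆ys Rxs Rys
Pointwise-image-⊆ functional (refl ∷ xs⊆ys) (Rxc ∷ Rxs) (Rxc′ ∷ Rys) =
  functional Rxc Rxc′ ∷ Pointwise-image-⊆ functional xs⊆ys Rxs Rys

enumerations-↭ : ∀ {xs ys : List A} → Unique xs → Unique ys → (∀ x → x ∈ xs) → (∀ y → y ∈ ys) → xs ↭ ys
enumerations-↭ xs-unique ys-unique ∈xs ∈ys =
  ∼bag⇒↭ (unique∧set⇒bag xs-unique ys-unique (mk⇔ (λ _ → ∈ys _) (λ _ → ∈xs _)))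

LastOf-functional : ∀ {C : List A} {c c′} → LastOf C c → LastOf C c′ → c ≡ c′
LastOf-functional (xs , refl) (ys , eq) = ∷ʳ-injectiveʳ xs ys eq

rot-≢[] : ∀ (T : List A) j → T ≢ [] → rot T j ≢ []
rot-≢[] T j T≢[] rotT≡[] = T≢[] (begin
  T                    ≡⟨ take++drop≡id j T ⟨
  take j T ++ drop j T ≡⟨ cong₂ _++_ (++-conicalʳ (drop j T) _ rotT≡[]) (++-conicalˡ _ _ rotT≡[]) ⟩
  []                   ∎)
  where open ≡-Reasoning

module _ (T : Str σ) (N : List (Str σ)) where

  at-first : Fin (length T) → Pos (T ∷ N)
  at-first j = Fin.zero , j

  at-later : Pos N → Pos (T ∷ N)
  at-later (i , j) = Fin.suc i , j

positions : (N : List (Str σ)) → List (Pos N)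
positions []      = []
positions (T ∷ N) = map (at-first T N) (allFin (length T)) ++ map (at-later T N) (positions N)

positions-complete : ∀ (N : List (Str σ)) p → p ∈ positions N
positions-complete (T ∷ N) (Fin.zero  , j) = ∈-++⁺ˡ (∈-map⁺ (at-first T N) (∈-allFin j))
positions-complete (T ∷ N) (Fin.suc i , j) = ∈-++⁺ʳ _ (∈-map⁺ (at-later T N) (positions-complete N (i , j)))

positions-unique : ∀ (N : List (Str σ)) → Unique (positions N)
positions-unique []      = AllPairs.[]
positions-unique (T ∷ N) =
  Unique.++⁺ (Unique.map⁺ first-injective (Unique.allFin⁺ (length T)))
             (Unique.map⁺ later-injective (positions-unique N))
             disjoint
  where
  first-injective : ∀ {j j′} → at-first T N j ≡ at-first T N j′ → j ≡ j′
  first-injective refl = refl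
  later-injective : ∀ {p q} → at-later T N p ≡ at-later T N q → p ≡ q
  later-injective {i , j} {.i , .j} refl = refl
  disjoint : ∀ {p} → ¬ (p ∈ map (at-first T N) (allFin (length T)) × p ∈ map (at-later T N) (positions N))
  disjoint (p∈first , p∈later) with ∈-map⁻ (at-first T N) p∈first | ∈-map⁻ (at-later T N) p∈later
  ... | _ , _ , refl | _ , _ , ()

rotations : List A → List (List A)
rotations T = map (rot T ∘ toℕ) (allFin (length T))

conjugates : List (List A) → List (List A)
conjugates = concatMap rotations

map-conj-positions : ∀ (N : List (Str σ)) → map (conj N) (positions N) ≡ conjugates N
map-conj-positions []      = refl
map-conj-positions (T ∷ N) =
  trans (map-++ (conj (T ∷ N)) (map (at-first T N) (allFin (length T))) (map (at-later T N) (positions N)))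
        (cong₂ _++_ (sym (map-∘ (allFin (length T))))
                    (trans (sym (map-∘ (positions N))) (map-conj-positions N)))

conjugates-↭ : ∀ {S R M : List (List A)} → S ++ R ↭ M → conjugates S ++ conjugates R ↭ conjugates M
conjugates-↭ {S = S} {R} S++R↭M =
  ↭-trans (↭-reflexive (sym (concatMap-++ rotations S R)))
          (∼bag⇒↭ (concat-cong (map-cong (λ _ → refl) (↭⇒∼bag S++R↭M))))

-- The tie-break in ConjLt is, definitionally, this order on (toℕ i , toℕ j).
_<ₗₑₓ_ : ℕ × ℕ → ℕ × ℕ → Set
_<ₗₑₓ_ = ×-Lex _≡_ _<_ _<_

<ₗₑₓ-trans : Transitive _<ₗₑₓ_
<ₗₑₓ-trans = ×-transitive {_<₁_ = _<_} {_<₂_ = _<_} isEquivalence (resp₂ _<_) <-trans <-trans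

module _ (N : List (Str σ)) where

  ConjLt-irrefl : Irreflexive _≡_ (ConjLt N)
  ConjLt-irrefl refl (inj₁ p≺p)                      = ≺ω-irrefl refl p≺p
  ConjLt-irrefl refl (inj₂ (_ , _ , inj₁ i<i))        = <-irrefl refl i<i
  ConjLt-irrefl refl (inj₂ (_ , _ , inj₂ (_ , j<j))) = <-irrefl refl j<j

  module _ (N≢[] : All (_≢ []) N) where

    conj-≢[] : ∀ p → conj N p ≢ []
    conj-≢[] (i , j) = rot-≢[] (lookup N i) (toℕ j) (All.lookup N≢[] (∈-lookup i))

    conj-tie⇒≡ : ∀ p q → ¬ conj N q ≺ω conj N p → ¬ conj N p ≺ω conj N q → conj N p ≡ conj N q
    conj-tie⇒≡ p q q⊀p p⊀q = ≺ω-tie⇒≡ (conj-≢[] p) (conj-≢[] q) p⊀q q⊀p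

    ConjLt⇒≼ω : ∀ {p q} → ConjLt N p q → conj N p ≼ω conj N q
    ConjLt⇒≼ω         (inj₁ p≺q)             = inj₁ p≺q
    ConjLt⇒≼ω {p} {q} (inj₂ (q⊀p , p⊀q , _)) = inj₂ (conj-tie⇒≡ p q q⊀p p⊀q)

    ConjLt-trans : Transitive (ConjLt N)
    ConjLt-trans (inj₁ p≺q) (inj₁ q≺r) = inj₁ (≺ω-trans p≺q q≺r)
    ConjLt-trans {p} {q} {r} (inj₁ p≺q) (inj₂ (r⊀q , q⊀r , _)) =
      inj₁ (subst (conj N p ≺ω_) (conj-tie⇒≡ q r r⊀q q⊀r) p≺q)
    ConjLt-trans {p} {q} {r} (inj₂ (q⊀p , p⊀q , _)) (inj₁ q≺r) =
      inj₁ (subst (_≺ω conj N r) (sym (conj-tie⇒≡ p q q⊀p p⊀q)) q≺r)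
    ConjLt-trans {p} {q} {r} (inj₂ (q⊀p , p⊀q , p<q)) (inj₂ (r⊀q , q⊀r , q<r)) =
      inj₂ (≺ω-irrefl (sym p≡r) , ≺ω-irrefl p≡r , <ₗₑₓ-trans p<q q<r)
      where
      p≡r : conj N p ≡ conj N r
      p≡r = trans (conj-tie⇒≡ p q q⊀p p⊀q) (conj-tie⇒≡ q r r⊀q q⊀r)

    Linked-ConjLt⇒Unique : ∀ {ps} → Linked (ConjLt N) ps → Unique ps
    Linked-ConjLt⇒Unique =
      AllPairs.map (λ p<q p≡q → ConjLt-irrefl p≡q p<q) ∘ Linked⇒AllPairs ConjLt-trans

SortedConjugates : List (Str σ) → Str σ → Set
SortedConjugates N L = ∃[ Cs ] (Linked _≼ω_ Cs × Cs ↭ conjugates N × Pointwise LastOf Cs L)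

IsEBWT⇒SortedConjugates : ∀ {N : List (Str σ)} {L} → All (_≢ []) N → IsEBWT N L → SortedConjugates N L
IsEBWT⇒SortedConjugates {N = N} {L} N≢[] (ps , complete , sorted , lasts) =
  map (conj N) ps ,
  Linked-map⁺ (Linked.map (ConjLt⇒≼ω N N≢[]) sorted) ,
  ↭-trans (↭-map⁺ (conj N) ps↭positions) (↭-reflexive (map-conj-positions N)) ,
  subst (Pointwise LastOf (map (conj N) ps)) (map-id L) (Pointwise.map⁺ (conj N) id lasts)
  where
  ps↭positions : ps ↭ positions N
  ps↭positions = enumerations-↭ (Linked-ConjLt⇒Unique N N≢[] sorted) (positions-unique N)
                                complete (positions-complete N)

SortedConjugates-⊆ : ∀ {S R M : List (Str σ)} {L₁ L₂} → S ++ R ↭ M →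
                     SortedConjugates S L₁ → SortedConjugates M L₂ → L₁ ⊆ L₂
SortedConjugates-⊆ {S = S} {R} S++R↭M (Cs₁ , sorted₁ , Cs₁↭ , lasts₁) (Cs₂ , sorted₂ , Cs₂↭ , lasts₂) =
  Pointwise-image-⊆ LastOf-functional Cs₁⊆Cs₂ lasts₁ lasts₂
  where
  Cs₁++R↭Cs₂ : Cs₁ ++ conjugates R ↭ Cs₂
  Cs₁++R↭Cs₂ = ↭-trans (++⁺ʳ (conjugates R) Cs₁↭) (↭-trans (conjugates-↭ {S = S} S++R↭M) (↭-sym Cs₂↭))
  Cs₁⊆Cs₂ : Cs₁ ⊆ Cs₂
  Cs₁⊆Cs₂ = sorted-++-↭⇒⊆ ≼ω-trans ≼ω-antisym sorted₁ sorted₂ Cs₁++R↭Cs₂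

EBWT-⊆ : ∀ {M S : List (Str σ)} {L₁ L₂} → All (_≢ []) M → SubMultiset S M →
         IsEBWT S L₁ → IsEBWT M L₂ → L₁ ⊆ L₂
EBWT-⊆ {S = S} M≢[] (R , S++R↭M) ebwt₁ ebwt₂ =
  SortedConjugates-⊆ {S = S} S++R↭M (IsEBWT⇒SortedConjugates S≢[] ebwt₁)
                                    (IsEBWT⇒SortedConjugates M≢[] ebwt₂)
  where
  S≢[] : All (_≢ []) S
  S≢[] = ++⁻ˡ S (All-resp-↭ (↭-sym S++R↭M) M≢[])

SubMultiset-map : ∀ {B C : Set} (f : B → C) {S M} → SubMultiset S M → SubMultiset (map f S) (map f M)
SubMultiset-map f {S} (R , S++R↭M) = map f R , subst (_↭ _) (map-++ f S R) (↭-map⁺ f S++R↭M)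

dol-≢[] : ∀ (T : Str σ) → dol T ≢ []
dol-≢[] T = (λ ()) ∘ ++-conicalʳ (map Fin.suc T) [ Fin.zero ]

proposition11 : (σ : ℕ) (M S : List (Str σ))
    → All (λ T → ¬ (T ≡ [])) M
    → SubMultiset S M
    → (∀ L₁ L₂ → IsEBWT S L₁ → IsEBWT M L₂ → L₁ ⊆ L₂)
      × (∀ L₁ L₂ → IsDolEBWT S L₁ → IsDolEBWT M L₂ → L₁ ⊆ L₂)
proposition11 σ M S M≢[] S⊆M =
  (λ _ _ → EBWT-⊆ M≢[] S⊆M) ,
  (λ _ _ → EBWT-⊆ (All-map⁺ (All.universal dol-≢[] M)) (SubMultiset-map dol S⊆M))
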